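{- If $L$ is a finite trim lattice, then $L$ contains no sublattice isomorphic to $M_3$.
   Context: $M_3$ is the five-element lattice consisting of a minimum, a maximum, and three pairwise incomparable elements; a sublattice is a subset closed under $\vee$ and $\wedge$. An element $x$ of a lattice $L$ is left modular if for all $y<z$ in $L$, $(y\vee x)\wedge z=y\vee(x\wedge z)$. A join-irreducible is an element other than $\hat0$ that is not the join of two strictly smaller elements; a meet-irreducible is an element other than $\hat1$ that is not the meet of two strictly larger elements. A lattice is trim if, for some $n$, it has a maximal chain of $n+1$ left modular elements and exactly $n$ join-irreducibles and exactly $n$ meet-irreducibles. -}

module Defs where

open import Level using (Level; _⊔_)
open import Data.Nat using (ℕ; suc)
open import Data.Fin using (Fin; zero; suc; inject₁)
open import Data.Product using (Σ; ∃; _×_; _,_)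
open import Data.Sum using (_⊎_)
open import Relation.Nullary using (¬_)
open import Relation.Binary.PropositionalEquality using (_≡_)
open import Relation.Binary.Lattice.Bundles using (Lattice)

data M3 : Set where
  bot top a₁ a₂ a₃ : M3

infixr 6 _∨₃_
infixr 7 _∧₃_

_∨₃_ : M3 → M3 → M3
bot ∨₃ y = y
top ∨₃ y = top
a₁ ∨₃ bot = a₁
a₁ ∨₃ a₁ = a₁
a₁ ∨₃ _ = top
a₂ ∨₃ bot = a₂
a₂ ∨₃ a₂ = a₂
a₂ ∨₃ _ = top
a₃ ∨₃ bot = a₃
a₃ ∨₃ a₃ = a₃
a₃ ∨₃ _ = top

_∧₃_ : M3 → M3 → M3
top ∧₃ y = y
bot ∧₃ y = bot
a₁ ∧₃ top = a₁
a₁ ∧₃ a₁ = a₁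
a₁ ∧₃ _ = bot
a₂ ∧₃ top = a₂
a₂ ∧₃ a₂ = a₂
a₂ ∧₃ _ = bot
a₃ ∧₃ top = a₃
a₃ ∧₃ a₃ = a₃
a₃ ∧₃ _ = bot

module _ {c ℓ₁ ℓ₂ : Level} (L : Lattice c ℓ₁ ℓ₂) where
  open Lattice L

  _<ₗ_ : Carrier → Carrier → Set (ℓ₁ ⊔ ℓ₂)
  x <ₗ y = x ≤ y × ¬ (x ≈ y)

  IsFinite : Set (c ⊔ ℓ₁)
  IsFinite = Σ ℕ λ n → Σ (Fin n → Carrier) λ f → ∀ x → ∃ λ i → f i ≈ x

  IsBottom : Carrier → Set (c ⊔ ℓ₂)
  IsBottom x = ∀ y → x ≤ y

  IsTop : Carrier → Set (c ⊔ ℓ₂)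
  IsTop x = ∀ y → y ≤ x

  LeftModular : Carrier → Set (c ⊔ ℓ₁ ⊔ ℓ₂)
  LeftModular x = ∀ y z → y <ₗ z → ((y ∨ x) ∧ z) ≈ (y ∨ (x ∧ z))

  JoinIrreducible : Carrier → Set (c ⊔ ℓ₁ ⊔ ℓ₂)
  JoinIrreducible x = ¬ IsBottom x × ¬ (∃ λ a → ∃ λ b → a <ₗ x × b <ₗ x × (a ∨ b) ≈ x)

  MeetIrreducible : Carrier → Set (c ⊔ ℓ₁ ⊔ ℓ₂)
  MeetIrreducible x = ¬ IsTop x × ¬ (∃ λ a → ∃ λ b → x <ₗ a × x <ₗ b × (a ∧ b) ≈ x)

  HasExactly : (Carrier → Set (c ⊔ ℓ₁ ⊔ ℓ₂)) → ℕ → Set (c ⊔ ℓ₁ ⊔ ℓ₂)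
  HasExactly P n = Σ (Fin n → Carrier) λ g →
    (∀ i j → g i ≈ g j → i ≡ j) × (∀ i → P (g i)) × (∀ x → P x → ∃ λ i → g i ≈ x)

  Comparable : Carrier → Carrier → Set ℓ₂
  Comparable x y = x ≤ y ⊎ y ≤ x

  IsMaximalChain : (n : ℕ) → (Fin (suc n) → Carrier) → Set (c ⊔ ℓ₁ ⊔ ℓ₂)
  IsMaximalChain n ch =
    (∀ (i : Fin n) → ch (inject₁ i) <ₗ ch (suc i)) ×
    (∀ x → (∀ i → Comparable x (ch i)) → ∃ λ i → ch i ≈ x)

  IsTrim : Set (c ⊔ ℓ₁ ⊔ ℓ₂)
  IsTrim = Σ ℕ λ n →
    (Σ (Fin (suc n) → Carrier) λ ch → IsMaximalChain n ch × (∀ i → LeftModular (ch i))) ×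
    HasExactly JoinIrreducible n × HasExactly MeetIrreducible n

  -- L has a sublattice isomorphic to M₃: an injective lattice homomorphism M₃ → L
  -- (its image is such a sublattice, and every such sublattice arises this way).
  HasM3Sublattice : Set (c ⊔ ℓ₁)
  HasM3Sublattice = Σ (M3 → Carrier) λ f →
    (∀ p q → f p ≈ f q → p ≡ q) ×
    (∀ p q → f (p ∨₃ q) ≈ (f p ∨ f q)) ×
    (∀ p q → f (p ∧₃ q) ≈ (f p ∧ f q))

-- Let c₀ < ⋯ < cₙ be the left-modular maximal chain. Every step cₛ < cₛ₊₁ is
-- crossed by a join-irreducible j (j ≤ cₛ₊₁, j ≰ cₛ), and different steps are
-- crossed by different join-irreducibles; as there are exactly n of them, each
-- step is crossed by exactly one. Suppose M₃ sits in L with bottom b and top t,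
-- and take a step s with t ≰ cₛ ∨ b but t ≤ cₛ₊₁ ∨ b (c₀ is the bottom of L and
-- cₙ its top). Two atoms cannot both lie below cₛ ∨ b (their join is t), so two
-- atoms p, q both cross from cₛ ∨ b to cₛ₊₁ ∨ b. Left modularity of cₛ₊₁ gives
-- p = b ∨ (cₛ₊₁ ∧ p), so below cₛ₊₁ ∧ p there is a join-irreducible crossing
-- step s that is not below b; likewise for q. By uniqueness the two coincide,
-- hence lie below p ∧ q = b: contradiction.
-- The conclusion is a negation, so the argument runs under double negation and
-- finiteness is only used to make the strict order well-founded.
module Submission where

open import Defs
open import Level using (Level; _⊔_)
open import Relation.Nullary using (¬_)
open import Relation.Binary.Lattice.Bundles using (Lattice)

import Data.Nat as ℕ
import Data.Nat.Properties as ℕ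
open import Data.Fin as Fin using (Fin; zero; suc; inject₁; fromℕ)
import Data.Fin.Properties as Fin
open import Data.Fin.Induction using (po-wellFounded; <-weakInduction; <-weakInduction-startingFrom)
open import Data.Product using (∃; _×_; _,_; proj₁; proj₂)
open import Data.Sum using (inj₁; inj₂)
open import Data.Empty using (⊥; ⊥-elim)
open import Induction.WellFounded using (WellFounded; Acc; acc)
import Relation.Binary.Construct.On as On
open import Relation.Binary.Definitions using (tri<; tri≈; tri>)
open import Relation.Binary.PropositionalEquality as ≡ using (_≡_; _≢_)
import Relation.Binary.Lattice.Properties.JoinSemilattice as JoinSemilatticeProperties
import Relation.Binary.Properties.Poset as PosetProperties
import Relation.Binary.Reasoning.PartialOrder as ≤-Reasoning
import Relation.Binary.Reasoning.Setoid as ≈-Reasoning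

¬¬-∀-Fin : ∀ {p n} {P : Fin n → Set p} → (∀ i → ¬ ¬ P i) → ¬ ¬ (∀ i → P i)
¬¬-∀-Fin {n = ℕ.zero} _ k = k λ ()
¬¬-∀-Fin {n = ℕ.suc n} h k =
  h zero λ P₀ → ¬¬-∀-Fin (λ i → h (suc i)) λ Pₛ →
  k λ { zero → P₀ ; (suc i) → Pₛ i }

¬¬-crossing : ∀ {q n} (Q : Fin (ℕ.suc n) → Set q) → ¬ Q zero → Q (fromℕ n) →
              ¬ ¬ ∃ λ s → ¬ Q (inject₁ s) × Q (suc s)
¬¬-crossing {n = n} Q ¬Q₀ Qₙ no-crossing =
  <-weakInduction (λ i → ¬ Q i) ¬Q₀ (λ s ¬Qₛ Qₛ₊₁ → no-crossing (s , ¬Qₛ , Qₛ₊₁))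
    (fromℕ n) Qₙ

data DistinctAtoms : M3 → M3 → Set where
  a₁a₂ : DistinctAtoms a₁ a₂
  a₁a₃ : DistinctAtoms a₁ a₃
  a₂a₃ : DistinctAtoms a₂ a₃

no-predicate-splits-every-atom-pair : ∀ {p} (P : M3 → Set p) →
  (∀ {a a'} → DistinctAtoms a a' → P a → P a' → ⊥) →
  (∀ {a a'} → DistinctAtoms a a' → ¬ P a → ¬ P a' → ⊥) → ⊥
no-predicate-splits-every-atom-pair P both neither = neither a₁a₂ ¬P₁ ¬P₂
  where
  ¬P₁ : ¬ P a₁
  ¬P₁ P₁ = neither a₂a₃ (both a₁a₂ P₁) (both a₁a₃ P₁)
  ¬P₂ : ¬ P a₂
  ¬P₂ P₂ = neither a₁a₃ (λ P₁ → both a₁a₂ P₁ P₂) (both a₂a₃ P₂)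

module _ {c ℓ₁ ℓ₂ : Level} (L : Lattice c ℓ₁ ℓ₂) where
  open Lattice L
  open JoinSemilatticeProperties joinSemilattice using (∨-comm)
  open PosetProperties poset using (_<_; <-respˡ-≈; <-respʳ-≈; <⇒≱)

  HasExactly⇒injection-≤ : ∀ {P m n} → HasExactly L P n →
    (f : Fin m → Carrier) → (∀ i → P (f i)) → (∀ {i k} → f i ≈ f k → i ≡ k) →
    m ℕ.≤ n
  HasExactly⇒injection-≤ {m = m} {n} (g , _ , _ , onto) f P-f f-injective =
    Fin.injective⇒≤ index-injective
    where
    index : Fin m → Fin n
    index i = proj₁ (onto (f i) (P-f i))
    index-correct : ∀ i → g (index i) ≈ f i
    index-correct i = proj₂ (onto (f i) (P-f i))
    index-injective : ∀ {i k} → index i ≡ index k → i ≡ k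
    index-injective {i} {k} index-i≡index-k = f-injective (begin
      f i         ≈⟨ Eq.sym (index-correct i) ⟩
      g (index i) ≡⟨ ≡.cong g index-i≡index-k ⟩
      g (index k) ≈⟨ index-correct k ⟩
      f k         ∎)
      where open ≈-Reasoning setoid

  finite⇒<-wellFounded : IsFinite L → WellFounded _<_
  finite⇒<-wellFounded (N , enum , onto) x = acc-of (index-wellFounded _) (proj₂ (onto x))
    where
    _<ᵢ_ : Fin N → Fin N → Set _
    i <ᵢ k = enum i < enum k
    index-wellFounded : WellFounded _<ᵢ_
    index-wellFounded = po-wellFounded (On.isPartialOrder enum isPartialOrder)
    acc-of : ∀ {i x} → Acc _<ᵢ_ i → enum i ≈ x → Acc _<_ x
    acc-of (acc below) i≈x = acc λ {y} y<x →
      let (k , k≈y) = onto y in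
      acc-of (below (<-respʳ-≈ (Eq.sym i≈x) (<-respˡ-≈ (Eq.sym k≈y) y<x))) k≈y

  Separates : Carrier → Carrier → Carrier → Set (c ⊔ ℓ₁ ⊔ ℓ₂)
  Separates j u v = JoinIrreducible L j × j ≤ u × ¬ j ≤ v

  UniqueSeparator : Carrier → Carrier → Set (c ⊔ ℓ₁ ⊔ ℓ₂)
  UniqueSeparator u v = ∀ {j j'} → Separates j u v → Separates j' u v → ¬ ¬ j ≈ j'

  ¬¬-separating-join-irreducible : WellFounded _<_ → ∀ {u v} → ¬ u ≤ v →
    ¬ ¬ ∃ λ j → Separates j u v
  ¬¬-separating-join-irreducible wf {u} = separate (wf u)
    where
    separate : ∀ {u v} → Acc _<_ u → ¬ u ≤ v → ¬ ¬ ∃ λ j → Separates j u v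
    separate {u} {v} (acc below) u≰v none = none (u , (u-not-bottom , u-not-split) , refl , u≰v)
      where
      ¬¬-below-v : ∀ {a} → a < u → ¬ ¬ a ≤ v
      ¬¬-below-v a<u a≰v = separate (below a<u) a≰v λ (j , j-irr , j≤a , j≰v) →
        none (j , j-irr , trans j≤a (proj₁ a<u) , j≰v)
      u-not-bottom : ¬ IsBottom L u
      u-not-bottom u-bottom = u≰v (u-bottom v)
      u-not-split : ¬ ∃ λ a → ∃ λ b → a < u × b < u × a ∨ b ≈ u
      u-not-split (a , b , a<u , b<u , a∨b≈u) =
        ¬¬-below-v a<u λ a≤v → ¬¬-below-v b<u λ b≤v →
        u≰v (trans (reflexive (Eq.sym a∨b≈u)) (∨-least a≤v b≤v))

  left-modular-below-join : ∀ {x y z} → LeftModular L x → y < z → z ≤ x ∨ y → z ≤ y ∨ (x ∧ z)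
  left-modular-below-join {x} {y} {z} x-modular y<z z≤x∨y = begin
    z           ≤⟨ ∧-greatest (trans z≤x∨y (reflexive (∨-comm x y))) refl ⟩
    (y ∨ x) ∧ z ≈⟨ x-modular y z y<z ⟩
    y ∨ (x ∧ z) ∎
    where open ≤-Reasoning poset

  left-modular-separator : WellFounded _<_ → ∀ {x x' b p} → LeftModular L x →
    b < p → p ≤ x ∨ b → ¬ p ≤ x' ∨ b → ¬ ¬ ∃ λ j → Separates j x x' × j ≤ p × ¬ j ≤ b
  left-modular-separator wf {x} {x'} {b} {p} x-modular b<p p≤x∨b p≰x'∨b found =
    ¬¬-separating-join-irreducible wf x∧p≰x'∨b λ (j , j-irr , j≤x∧p , j≰x'∨b) →
    found (j , (j-irr , trans j≤x∧p (x∧y≤x x p) , λ j≤x' → j≰x'∨b (trans j≤x' (x≤x∨y x' b)))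
             , trans j≤x∧p (x∧y≤y x p)
             , λ j≤b → j≰x'∨b (trans j≤b (y≤x∨y x' b)))
    where
    x∧p≰x'∨b : ¬ x ∧ p ≤ x' ∨ b
    x∧p≰x'∨b x∧p≤x'∨b = p≰x'∨b (trans (left-modular-below-join x-modular b<p p≤x∨b)
                                       (∨-least (y≤x∨y x' b) x∧p≤x'∨b))

  disjoint-pair-cannot-cross : WellFounded _<_ → ∀ {x x' b p q} →
    LeftModular L x → UniqueSeparator x x' →
    b < p → b < q → p ∧ q ≈ b → p ≤ x ∨ b → q ≤ x ∨ b → ¬ p ≤ x' ∨ b → ¬ q ≤ x' ∨ b → ⊥
  disjoint-pair-cannot-cross wf x-modular unique b<p b<q p∧q≈b p≤x∨b q≤x∨b p≰x'∨b q≰x'∨b =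
    left-modular-separator wf x-modular b<p p≤x∨b p≰x'∨b λ (jp , jp-separates , jp≤p , jp≰b) →
    left-modular-separator wf x-modular b<q q≤x∨b q≰x'∨b λ (jq , jq-separates , jq≤q , _) →
    unique jp-separates jq-separates λ jp≈jq →
    jp≰b (trans (∧-greatest jp≤p (trans (reflexive jp≈jq) jq≤q)) (reflexive p∧q≈b))

  module StrictChain {n} {ch : Fin (ℕ.suc n) → Carrier}
                     (increasing : ∀ i → ch (inject₁ i) < ch (suc i)) where

    chain-monotone : ∀ {i k} → i Fin.≤ k → ch i ≤ ch k
    chain-monotone {i} = <-weakInduction-startingFrom (λ k → ch i ≤ ch k) refl
      (λ k i≤k → trans i≤k (proj₁ (increasing k)))

    Crosses : Carrier → Fin n → Set ℓ₂
    Crosses x s = x ≤ ch (suc s) × ¬ x ≤ ch (inject₁ s)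

    crosses-not-earlier : ∀ {x y s t} → x ≈ y → Crosses x s → Crosses y t → ¬ s Fin.< t
    crosses-not-earlier {t = t} x≈y (x≤chₛ₊₁ , _) (_ , y≰chₜ) s<t =
      y≰chₜ (trans (reflexive (Eq.sym x≈y)) (trans x≤chₛ₊₁ (chain-monotone s+1≤t)))
      where
      s+1≤t : suc _ Fin.≤ inject₁ t
      s+1≤t = ≡.subst (ℕ._≤_ _) (≡.sym (Fin.toℕ-inject₁ t)) s<t

    crosses-unique : ∀ {x y s t} → x ≈ y → Crosses x s → Crosses y t → s ≡ t
    crosses-unique {s = s} {t} x≈y x-crosses y-crosses with Fin.<-cmp s t
    ... | tri< s<t _ _ = ⊥-elim (crosses-not-earlier x≈y x-crosses y-crosses s<t)
    ... | tri≈ _ s≡t _ = s≡t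
    ... | tri> _ _ t<s = ⊥-elim (crosses-not-earlier (Eq.sym x≈y) y-crosses x-crosses t<s)

    StepSeparators : Set (c ⊔ ℓ₁ ⊔ ℓ₂)
    StepSeparators = ∀ s → ∃ λ j → Separates j (ch (suc s)) (ch (inject₁ s))

    separator-is-chosen : HasExactly L (JoinIrreducible L) n → (chosen : StepSeparators) →
      ∀ {j s} → Separates j (ch (suc s)) (ch (inject₁ s)) → ¬ ¬ j ≈ proj₁ (chosen s)
    separator-is-chosen exactly chosen {j} {s} (j-irr , j-crosses) j≉chosen =
      ℕ.1+n≰n (HasExactly⇒injection-≤ exactly f f-irreducible f-injective)
      where
      f : Fin (ℕ.suc n) → Carrier
      f zero    = j
      f (suc t) = proj₁ (chosen t)
      f-irreducible : ∀ i → JoinIrreducible L (f i)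
      f-irreducible zero    = j-irr
      f-irreducible (suc t) = proj₁ (proj₂ (chosen t))
      chosen-crosses : ∀ t → Crosses (proj₁ (chosen t)) t
      chosen-crosses t = proj₂ (proj₂ (chosen t))
      f-injective : ∀ {i k} → f i ≈ f k → i ≡ k
      f-injective {zero}  {zero}  _     = ≡.refl
      f-injective {zero}  {suc t} j≈cₜ  =
        ⊥-elim (≡.subst (λ t → ¬ j ≈ proj₁ (chosen t))
                  (crosses-unique j≈cₜ j-crosses (chosen-crosses t)) j≉chosen j≈cₜ)
      f-injective {suc t} {zero}  cₜ≈j  = ≡.sym (f-injective (Eq.sym cₜ≈j))
      f-injective {suc t} {suc u} cₜ≈cᵤ =
        ≡.cong suc (crosses-unique cₜ≈cᵤ (chosen-crosses t) (chosen-crosses u))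

    step-separators-unique : WellFounded _<_ → HasExactly L (JoinIrreducible L) n →
      ∀ s → UniqueSeparator (ch (suc s)) (ch (inject₁ s))
    step-separators-unique wf exactly s j-separates j'-separates j≉j' =
      ¬¬-∀-Fin (λ t → ¬¬-separating-join-irreducible wf (<⇒≱ (increasing t))) λ chosen →
      separator-is-chosen exactly chosen j-separates λ j≈c →
      separator-is-chosen exactly chosen j'-separates λ j'≈c →
      j≉j' (Eq.trans j≈c (Eq.sym j'≈c))

  module MaximalChain {n} {ch : Fin (ℕ.suc n) → Carrier} (chain : IsMaximalChain L n ch) where
    open StrictChain {ch = ch} (proj₁ chain) public

    chain-bottom : IsBottom L (ch zero)
    chain-bottom y =
      let (k , chₖ≈ch₀∧y) = proj₂ chain (ch zero ∧ y)
                               (λ i → inj₁ (trans (x∧y≤x _ _) (chain-monotone ℕ.z≤n))) in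
      trans (chain-monotone ℕ.z≤n) (trans (reflexive chₖ≈ch₀∧y) (x∧y≤y _ _))

    chain-top : IsTop L (ch (fromℕ n))
    chain-top y =
      let (k , chₖ≈chₙ∨y) = proj₂ chain (ch (fromℕ n) ∨ y)
                               (λ i → inj₂ (trans (chain-monotone (Fin.≤fromℕ i)) (x≤x∨y _ _))) in
      trans (y≤x∨y _ _) (trans (reflexive (Eq.sym chₖ≈chₙ∨y)) (chain-monotone (Fin.≤fromℕ k)))

  module M3Embedding (φ : M3 → Carrier) (φ-injective : ∀ p q → φ p ≈ φ q → p ≡ q)
                     (φ-∨ : ∀ p q → φ (p ∨₃ q) ≈ φ p ∨ φ q)
                     (φ-∧ : ∀ p q → φ (p ∧₃ q) ≈ φ p ∧ φ q) where

    φ-monotone : ∀ {p q} → p ∨₃ q ≡ q → φ p ≤ φ q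
    φ-monotone {p} {q} p∨q≡q =
      ≡.subst (λ r → φ p ≤ φ r) p∨q≡q (trans (x≤x∨y _ _) (reflexive (Eq.sym (φ-∨ p q))))

    below-top : ∀ p → φ p ≤ φ top
    below-top bot = φ-monotone ≡.refl
    below-top top = φ-monotone ≡.refl
    below-top a₁  = φ-monotone ≡.refl
    below-top a₂  = φ-monotone ≡.refl
    below-top a₃  = φ-monotone ≡.refl

    top≰bot : ¬ φ top ≤ φ bot
    top≰bot top≤bot with φ-injective top bot (antisym top≤bot (below-top bot))
    ... | ()

    bot<nonbot : ∀ {p} → p ≢ bot → φ bot < φ p
    bot<nonbot p≢bot = φ-monotone ≡.refl , λ bot≈p → p≢bot (≡.sym (φ-injective _ _ bot≈p))

    bot<atoms : ∀ {p q} → DistinctAtoms p q → φ bot < φ p × φ bot < φ q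
    bot<atoms a₁a₂ = bot<nonbot (λ ()) , bot<nonbot (λ ())
    bot<atoms a₁a₃ = bot<nonbot (λ ()) , bot<nonbot (λ ())
    bot<atoms a₂a₃ = bot<nonbot (λ ()) , bot<nonbot (λ ())

    atoms-meet : ∀ {p q} → DistinctAtoms p q → φ p ∧ φ q ≈ φ bot
    atoms-meet a₁a₂ = Eq.sym (φ-∧ a₁ a₂)
    atoms-meet a₁a₃ = Eq.sym (φ-∧ a₁ a₃)
    atoms-meet a₂a₃ = Eq.sym (φ-∧ a₂ a₃)

    atoms-join : ∀ {p q} → DistinctAtoms p q → φ p ∨ φ q ≈ φ top
    atoms-join a₁a₂ = Eq.sym (φ-∨ a₁ a₂)
    atoms-join a₁a₃ = Eq.sym (φ-∨ a₁ a₃)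
    atoms-join a₂a₃ = Eq.sym (φ-∨ a₂ a₃)

lemma3 : {c ℓ₁ ℓ₂ : Level} (L : Lattice c ℓ₁ ℓ₂) → IsFinite L → IsTrim L → ¬ HasM3Sublattice L
lemma3 L finite (n , (ch , chain , modular) , exactly , _) (φ , φ-injective , φ-∨ , φ-∧) =
  ¬¬-crossing (λ i → φ top ≤ ch i ∨ φ bot) top≰ch₀∨bot top≤chₙ∨bot λ (s , top≰ , top≤) →
  no-predicate-splits-every-atom-pair (λ p → φ p ≤ ch (inject₁ s) ∨ φ bot)
    (λ pq p≤ q≤ → top≰ (trans (reflexive (Eq.sym (atoms-join pq))) (∨-least p≤ q≤)))
    (λ pq → disjoint-pair-cannot-cross L wf (modular (suc s)) (step-separators-unique wf exactly s)
              (proj₁ (bot<atoms pq)) (proj₂ (bot<atoms pq)) (atoms-meet pq)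
              (trans (below-top _) top≤) (trans (below-top _) top≤))
  where
  open Lattice L
  open M3Embedding L φ φ-injective φ-∨ φ-∧
  open MaximalChain L chain
  wf : WellFounded (_<ₗ_ L)
  wf = finite⇒<-wellFounded L finite
  top≰ch₀∨bot : ¬ φ top ≤ ch zero ∨ φ bot
  top≰ch₀∨bot top≤ = top≰bot (trans top≤ (∨-least (chain-bottom (φ bot)) refl))
  top≤chₙ∨bot : φ top ≤ ch (fromℕ n) ∨ φ bot
  top≤chₙ∨bot = trans (chain-top (φ top)) (x≤x∨y _ _)
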